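{- Let $s$ be an even integer and $t$ an odd integer. For every integer $n\ge0$, $$\nu(\{n\}!)=\nu(n!)+\lfloor n/2\rfloor\,\nu(s/2).$$
   Context: For integers $s,t$, let $\{n\}=\{n\}_{s,t}$ be defined by $\{0\}=0$, $\{1\}=1$, $\{n\}=s\{n-1\}+t\{n-2\}$ for $n\ge2$, and $\{n\}!=\{1\}\{2\}\cdots\{n\}$. $\nu=\nu_2$ is the $2$-adic valuation ($\nu(0)=\infty$). -}

module Defs where

open import Data.Nat as ℕ using (ℕ; zero; suc; _/_; _%_)
open import Data.Integer as ℤ using (ℤ; +_; ∣_∣)
open import Data.Maybe using (Maybe; just; nothing)

lucasU : ℤ → ℤ → ℕ → ℤ
lucasU s t zero = + 0
lucasU s t (suc zero) = + 1
lucasU s t (suc (suc n)) = s ℤ.* lucasU s t (suc n) ℤ.+ t ℤ.* lucasU s t n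

lucasFact : ℤ → ℤ → ℕ → ℤ
lucasFact s t zero = + 1
lucasFact s t (suc n) = lucasFact s t n ℤ.* lucasU s t (suc n)

ℕ∞ : Set
ℕ∞ = Maybe ℕ

∞ : ℕ∞
∞ = nothing

_+∞_ : ℕ∞ → ℕ∞ → ℕ∞
just a +∞ just b = just (a ℕ.+ b)
_ +∞ _ = nothing

-- scalar multiple n·v with the convention 0·∞ = 0
_·∞_ : ℕ → ℕ∞ → ℕ∞
zero ·∞ _ = just 0
suc n ·∞ just b = just (suc n ℕ.* b)
suc n ·∞ nothing = nothing

-- 2-adic valuation of a positive natural, computed with fuel (fuel ≥ m suffices)
ν₂-aux : ℕ → ℕ → ℕ
ν₂-aux zero m = 0
ν₂-aux (suc fuel) zero = 0
ν₂-aux (suc fuel) (suc m) with suc m % 2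
... | zero = suc (ν₂-aux fuel (suc m / 2))
... | suc _ = 0

ν : ℤ → ℕ∞
ν x with ∣ x ∣
... | zero = ∞
... | suc m = just (ν₂-aux (suc m) (suc m))

open import Data.Product using (∃)
open import Relation.Binary.PropositionalEquality using (_≡_)

EvenInt : ℤ → Set
EvenInt x = ∃ λ m → x ≡ + 2 ℤ.* m

OddInt : ℤ → Set
OddInt x = ∃ λ m → x ≡ + 2 ℤ.* m ℤ.+ + 1

-- s/2 (exact when s is even): halves the absolute value, keeps the sign
half : ℤ → ℤ
half (+ n) = + (n / 2)
half (ℤ.-[1+ n ]) = ℤ.- (+ (suc n / 2))

module Submission where

-- The odd-indexed terms {2k+1} are odd because s is even. The even-indexed terms bisect as
-- {2k} = s·W k, where W is the Lucas sequence with parameters P = s² + 2t ≡ 2 (mod 4) and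
-- Q = −t² odd; its companion sequence V is then ≡ 2 (mod 4), so the doubling formula
-- W (2m) = W m · V m gives ν(W k) = ν(k). Hence ν({n}) = ν(n) + [n even]·ν(s/2), and summing
-- over 1..n gives the formula. For s = 0 both sides are ∞ once n ≥ 2, since {2} = s = 0.

open import Defs
open import Data.Nat using (ℕ; _/_; _!)
open import Data.Integer using (ℤ; +_; _*_)
open import Relation.Binary.PropositionalEquality using (_≡_)

open import Data.Nat as ℕ using (zero; suc; _^_; _<_; _%_; z≤n; s≤s)
import Data.Nat.Properties as ℕ
open import Data.Nat.DivMod using (m*n%n≡0; m*n/n≡m; [m+kn]%n≡m%n; +-distrib-/-∣ʳ; m/n≡1+[m∸n]/n)
open import Data.Nat.Divisibility using (m∣m*n)
open import Data.Nat.Induction using (<-rec)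
import Data.Nat.Tactic.RingSolver as ℕ-Solver
open import Data.Integer using (_+_; _-_; -_; -[1+_]; ∣_∣)
import Data.Integer.Properties as ℤ
open import Data.Integer.Tactic.RingSolver using (solve-∀)
open import Data.Product using (∃; ∃₂; _,_; proj₂)
open import Data.Sum using (_⊎_; inj₁; inj₂)
open import Data.Maybe using (just; nothing)
open import Data.Empty using (⊥-elim)
open import Function using (_∘_)
open import Relation.Binary.PropositionalEquality
  using (refl; sym; trans; cong; cong₂; subst; subst₂; module ≡-Reasoning)

even-* : ∀ {x} → EvenInt x → ∀ y → EvenInt (x * y)
even-* (m , refl) y = m * y , ℤ.*-assoc (+ 2) m y

even+odd : ∀ {x y} → EvenInt x → OddInt y → OddInt (x + y)
even+odd (m , refl) (n , refl) = m + n , regroup m n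
  where
  regroup : ∀ m n → + 2 * m + (+ 2 * n + + 1) ≡ + 2 * (m + n) + + 1
  regroup = solve-∀

odd-* : ∀ {x y} → OddInt x → OddInt y → OddInt (x * y)
odd-* (m , refl) (n , refl) = + 2 * m * n + m + n , expand m n
  where
  expand : ∀ m n → (+ 2 * m + + 1) * (+ 2 * n + + 1) ≡ + 2 * (+ 2 * m * n + m + n) + + 1
  expand = solve-∀

odd-neg : ∀ {x} → OddInt x → OddInt (- x)
odd-neg (m , refl) = - m - + 1 , expand m
  where
  expand : ∀ m → - (+ 2 * m + + 1) ≡ + 2 * (- m - + 1) + + 1
  expand = solve-∀

odd-1+2* : ∀ j → OddInt (+ suc (2 ℕ.* j))
odd-1+2* j = + j , (begin
  + (1 ℕ.+ 2 ℕ.* j)     ≡⟨ ℤ.pos-+ 1 (2 ℕ.* j) ⟩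
  + 1 + + (2 ℕ.* j)     ≡⟨ ℤ.+-comm (+ 1) (+ (2 ℕ.* j)) ⟩
  + (2 ℕ.* j) + + 1     ≡⟨ cong (_+ + 1) (ℤ.pos-* 2 j) ⟩
  + 2 * + j + + 1       ∎)
  where open ≡-Reasoning

odd-∣∣ : ∀ {x} → OddInt x → ∃ λ j → ∣ x ∣ ≡ suc (2 ℕ.* j)
odd-∣∣ (+ j , refl) = j , cong ∣_∣ (sym (proj₂ (odd-1+2* j)))
odd-∣∣ (-[1+ j ] , refl) = j , (begin
  ∣ + 2 * -[1+ j ] + + 1 ∣     ≡⟨ cong ∣_∣ (reflect (+ j)) ⟩
  ∣ - (+ 2 * + j + + 1) ∣      ≡⟨ ℤ.∣-i∣≡∣i∣ (+ 2 * + j + + 1) ⟩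
  ∣ + 2 * + j + + 1 ∣          ≡⟨ cong ∣_∣ (sym (proj₂ (odd-1+2* j))) ⟩
  suc (2 ℕ.* j)                ∎)
  where
  open ≡-Reasoning
  reflect : ∀ x → + 2 * (- (+ 1 + x)) + + 1 ≡ - (+ 2 * x + + 1)
  reflect = solve-∀

record Val₂ (x : ℤ) (k : ℕ) : Set where
  constructor val₂
  field
    oddPart : ℤ
    oddPart-odd : OddInt oddPart
    factorisation : x ≡ + (2 ^ k) * oddPart

pos-2^-+ : ∀ k l → + (2 ^ (k ℕ.+ l)) ≡ + (2 ^ k) * + (2 ^ l)
pos-2^-+ k l = trans (cong +_ (ℕ.^-distribˡ-+-* 2 k l)) (ℤ.pos-* (2 ^ k) (2 ^ l))

Val₂-odd : ∀ {x} → OddInt x → Val₂ x 0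
Val₂-odd {x} x-odd = val₂ x x-odd (sym (ℤ.*-identityˡ x))

Val₂-2 : Val₂ (+ 2) 1
Val₂-2 = val₂ (+ 1) (+ 0 , refl) refl

Val₂-* : ∀ {x y k l} → Val₂ x k → Val₂ y l → Val₂ (x * y) (k ℕ.+ l)
Val₂-* {k = k} {l} (val₂ o o-odd refl) (val₂ o′ o′-odd refl) =
  val₂ (o * o′) (odd-* o-odd o′-odd) (begin
    + (2 ^ k) * o * (+ (2 ^ l) * o′)   ≡⟨ interchange (+ (2 ^ k)) (+ (2 ^ l)) o o′ ⟩
    + (2 ^ k) * + (2 ^ l) * (o * o′)   ≡⟨ cong (_* (o * o′)) (sym (pos-2^-+ k l)) ⟩
    + (2 ^ (k ℕ.+ l)) * (o * o′)       ∎)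
  where
  open ≡-Reasoning
  interchange : ∀ a b c d → a * c * (b * d) ≡ a * b * (c * d)
  interchange = solve-∀

Val₂-neg : ∀ {x k} → Val₂ x k → Val₂ (- x) k
Val₂-neg {k = k} (val₂ o o-odd refl) =
  val₂ (- o) (odd-neg o-odd) (ℤ.neg-distribʳ-* (+ (2 ^ k)) o)

Val₂-suc⇒even : ∀ {x k} → Val₂ x (suc k) → EvenInt x
Val₂-suc⇒even {k = k} (val₂ o _ refl) =
  + (2 ^ k) * o , trans (cong (_* o) (ℤ.pos-* 2 (2 ^ k))) (ℤ.*-assoc (+ 2) (+ (2 ^ k)) o)

Val₂-+ : ∀ {x y k l} → l < k → Val₂ x k → Val₂ y l → Val₂ (x + y) l
Val₂-+ {l = l} l<k (val₂ o o-odd refl) (val₂ o′ o′-odd refl) with ℕ.m≤n⇒∃[o]m+o≡n l<k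
... | d , refl = val₂ (+ 2 * (+ (2 ^ d) * o) + o′)
  (even+odd (+ (2 ^ d) * o , refl) o′-odd)
  (begin
    + (2 ^ (suc l ℕ.+ d)) * o + + (2 ^ l) * o′
      ≡⟨ cong (λ p → p * o + + (2 ^ l) * o′) (trans (cong (λ m → + (2 ^ m)) (sym (ℕ.+-suc l d))) (pos-2^-+ l (suc d))) ⟩
    + (2 ^ l) * + (2 ^ suc d) * o + + (2 ^ l) * o′
      ≡⟨ cong (λ p → + (2 ^ l) * p * o + + (2 ^ l) * o′) (ℤ.pos-* 2 (2 ^ d)) ⟩
    + (2 ^ l) * (+ 2 * + (2 ^ d)) * o + + (2 ^ l) * o′
      ≡⟨ factor-out (+ (2 ^ l)) (+ (2 ^ d)) o o′ ⟩
    + (2 ^ l) * (+ 2 * (+ (2 ^ d) * o) + o′)   ∎)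
  where
  open ≡-Reasoning
  factor-out : ∀ a b c d → a * (+ 2 * b) * c + a * d ≡ a * (+ 2 * (b * c) + d)
  factor-out = solve-∀

even-or-odd : ∀ n → ∃ λ k → n ≡ 2 ℕ.* k ⊎ n ≡ suc (2 ℕ.* k)
even-or-odd zero = 0 , inj₁ refl
even-or-odd (suc n) with even-or-odd n
... | k , inj₁ refl = k , inj₂ refl
... | k , inj₂ refl = suc k , inj₁ (sym (ℕ.*-suc 2 k))

2*n%2≡0 : ∀ n → 2 ℕ.* n % 2 ≡ 0
2*n%2≡0 n = trans (cong (_% 2) (ℕ.*-comm 2 n)) (m*n%n≡0 n 2)

2*n/2≡n : ∀ n → 2 ℕ.* n / 2 ≡ n
2*n/2≡n n = trans (cong (_/ 2) (ℕ.*-comm 2 n)) (m*n/n≡m n 2)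

[1+2*n]%2≡1 : ∀ n → suc (2 ℕ.* n) % 2 ≡ 1
[1+2*n]%2≡1 n = trans (cong (λ m → suc m % 2) (ℕ.*-comm 2 n)) ([m+kn]%n≡m%n 1 n 2)

[1+2*n]/2≡n : ∀ n → suc (2 ℕ.* n) / 2 ≡ n
[1+2*n]/2≡n n = trans (+-distrib-/-∣ʳ 1 {2 ℕ.* n} {2} (m∣m*n n)) (2*n/2≡n n)

[2+n]/2≡1+n/2 : ∀ n → suc (suc n) / 2 ≡ suc (n / 2)
[2+n]/2≡1+n/2 n = m/n≡1+[m∸n]/n {suc (suc n)} {2} (s≤s (s≤s z≤n))

2^[1+g]*n : ∀ g n → 2 ^ suc g ℕ.* n ≡ 2 ℕ.* (2 ^ g ℕ.* n)
2^[1+g]*n g n = ℕ.*-assoc 2 (2 ^ g) n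

1+n≡2^g*odd : ∀ n → ∃₂ λ g j → suc n ≡ 2 ^ g ℕ.* suc (2 ℕ.* j)
1+n≡2^g*odd = <-rec _ split
  where
  split : ∀ n → (∀ {m} → m < n → ∃₂ λ g j → suc m ≡ 2 ^ g ℕ.* suc (2 ℕ.* j)) →
          ∃₂ λ g j → suc n ≡ 2 ^ g ℕ.* suc (2 ℕ.* j)
  split n rec with even-or-odd n
  ... | k , inj₁ refl = 0 , k , sym (ℕ.*-identityˡ _)
  ... | k , inj₂ refl with rec (s≤s (ℕ.m≤n*m k 2))
  ...   | g , j , 1+k≡ = suc g , j , (begin
    suc (suc (2 ℕ.* k))             ≡⟨ ℕ.*-suc 2 k ⟨
    2 ℕ.* suc k                     ≡⟨ cong (2 ℕ.*_) 1+k≡ ⟩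
    2 ℕ.* (2 ^ g ℕ.* suc (2 ℕ.* j)) ≡⟨ 2^[1+g]*n g _ ⟨
    2 ^ suc g ℕ.* suc (2 ℕ.* j)     ∎)
    where open ≡-Reasoning

Val₂-2^g*odd : ∀ {n} g j → n ≡ 2 ^ g ℕ.* suc (2 ℕ.* j) → Val₂ (+ n) g
Val₂-2^g*odd g j refl = val₂ (+ suc (2 ℕ.* j)) (odd-1+2* j) (ℤ.pos-* (2 ^ g) _)

zero⊎Val₂ : ∀ x → x ≡ + 0 ⊎ ∃ (Val₂ x)
zero⊎Val₂ (+ zero) = inj₁ refl
zero⊎Val₂ (+ suc n) with 1+n≡2^g*odd n
... | g , j , eq = inj₂ (g , Val₂-2^g*odd g j eq)
zero⊎Val₂ -[1+ n ] with 1+n≡2^g*odd n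
... | g , j , eq = inj₂ (g , Val₂-neg (Val₂-2^g*odd g j eq))

k<2^k : ∀ k → k < 2 ^ k
k<2^k zero = s≤s z≤n
k<2^k (suc k) = ℕ.≤-trans (s≤s (k<2^k k)) (ℕ.+-mono-≤ (ℕ.m^n>0 2 k) (ℕ.m≤m+n (2 ^ k) 0))

k<2^k*odd : ∀ k j → k < 2 ^ k ℕ.* suc (2 ℕ.* j)
k<2^k*odd k j = ℕ.<-≤-trans (k<2^k k) (ℕ.m≤m*n (2 ^ k) (suc (2 ℕ.* j)))

ν₂-aux-odd : ∀ f m → suc m % 2 ≡ 1 → ν₂-aux (suc f) (suc m) ≡ 0
ν₂-aux-odd f m eq rewrite eq = refl

ν₂-aux-even : ∀ f m → suc m % 2 ≡ 0 → ν₂-aux (suc f) (suc m) ≡ suc (ν₂-aux f (suc m / 2))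
ν₂-aux-even f m eq rewrite eq = refl

ν₂-aux-2^k*odd : ∀ {f n} k j → n ≡ 2 ^ k ℕ.* suc (2 ℕ.* j) → k < f → ν₂-aux f n ≡ k
ν₂-aux-2^k*odd {zero} k j eq ()
ν₂-aux-2^k*odd {suc f} {zero} k j eq _ = ⊥-elim (ℕ.n≮0 (subst (k <_) (sym eq) (k<2^k*odd k j)))
ν₂-aux-2^k*odd {suc f} {suc m} zero j eq _ =
  ν₂-aux-odd f m (subst (λ n → n % 2 ≡ 1) (sym (trans eq (ℕ.*-identityˡ _))) ([1+2*n]%2≡1 j))
ν₂-aux-2^k*odd {suc f} {suc m} (suc k) j eq (s≤s k<f) = begin
  ν₂-aux (suc f) (suc m)       ≡⟨ ν₂-aux-even f m (subst (λ n → n % 2 ≡ 0) (sym halves) (2*n%2≡0 (2 ^ k ℕ.* suc (2 ℕ.* j)))) ⟩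
  suc (ν₂-aux f (suc m / 2))   ≡⟨ cong suc (ν₂-aux-2^k*odd k j halved k<f) ⟩
  suc k                        ∎
  where
  open ≡-Reasoning
  halves : suc m ≡ 2 ℕ.* (2 ^ k ℕ.* suc (2 ℕ.* j))
  halves = trans eq (2^[1+g]*n k _)
  halved : suc m / 2 ≡ 2 ^ k ℕ.* suc (2 ℕ.* j)
  halved = trans (cong (_/ 2) halves) (2*n/2≡n _)

Val₂⇒∣∣ : ∀ {x k} → Val₂ x k → ∃ λ j → ∣ x ∣ ≡ 2 ^ k ℕ.* suc (2 ℕ.* j)
Val₂⇒∣∣ {k = k} (val₂ o o-odd refl) with odd-∣∣ o-odd
... | j , ∣o∣≡ = j , trans (ℤ.abs-* (+ (2 ^ k)) o) (cong (2 ^ k ℕ.*_) ∣o∣≡)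

Val₂⇒ν : ∀ {x k} → Val₂ x k → ν x ≡ just k
Val₂⇒ν {x} {k} v with Val₂⇒∣∣ v
... | j , ∣x∣≡ with ∣ x ∣ | ∣x∣≡
...   | zero  | 0≡ = ⊥-elim (ℕ.n≮0 (subst (k <_) (sym 0≡) (k<2^k*odd k j)))
...   | suc n | eq = cong just (ν₂-aux-2^k*odd k j eq (subst (k <_) (sym eq) (k<2^k*odd k j)))

lucasV : ℤ → ℤ → ℕ → ℤ
lucasV P Q zero = + 2
lucasV P Q (suc zero) = P
lucasV P Q (suc (suc n)) = P * lucasV P Q (suc n) + Q * lucasV P Q n

module _ (P Q : ℤ) where

  private
    U V : ℕ → ℤ
    U = lucasU P Q
    V = lucasV P Q

  lucasU-+ : ∀ m n → U (suc (m ℕ.+ n)) ≡ U (suc m) * U (suc n) + Q * U m * U n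
  lucasU-+ zero n = base Q (U (suc n)) (U n)
    where
    base : ∀ Q a b → a ≡ + 1 * a + Q * + 0 * b
    base = solve-∀
  lucasU-+ (suc m) n = begin
    U (suc (suc (m ℕ.+ n)))                              ≡⟨ cong (U ∘ suc) (ℕ.+-suc m n) ⟨
    U (suc (m ℕ.+ suc n))                                ≡⟨ lucasU-+ m (suc n) ⟩
    U (suc m) * U (suc (suc n)) + Q * U m * U (suc n)   ≡⟨ shift P Q (U (suc m)) (U m) (U (suc n)) (U n) ⟩
    U (suc (suc m)) * U (suc n) + Q * U (suc m) * U n   ∎
    where
    open ≡-Reasoning
    shift : ∀ P Q a b c d → a * (P * c + Q * d) + Q * b * c ≡ (P * a + Q * b) * c + Q * a * d
    shift = solve-∀

  lucasV-suc : ∀ n → V (suc n) ≡ U (suc (suc n)) + Q * U n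
  lucasV-suc zero = initial P Q
    where
    initial : ∀ P Q → P ≡ P * + 1 + Q * + 0 + Q * + 0
    initial = solve-∀
  lucasV-suc (suc zero) = initial P Q
    where
    initial : ∀ P Q → P * P + Q * + 2 ≡ P * (P * + 1 + Q * + 0) + Q * + 1 + Q * + 1
    initial = solve-∀
  lucasV-suc (suc (suc n)) = begin
    P * V (suc (suc n)) + Q * V (suc n)
      ≡⟨ cong₂ (λ a b → P * a + Q * b) (lucasV-suc (suc n)) (lucasV-suc n) ⟩
    P * (U (suc (suc (suc n))) + Q * U (suc n)) + Q * (U (suc (suc n)) + Q * U n)
      ≡⟨ recurrence P Q (U (suc n)) (U n) ⟩
    U (suc (suc (suc (suc n)))) + Q * U (suc (suc n))   ∎
    where
    open ≡-Reasoning
    recurrence : ∀ P Q a b → P * ((P * (P * a + Q * b) + Q * a) + Q * a) + Q * ((P * a + Q * b) + Q * b)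
                       ≡ (P * (P * (P * a + Q * b) + Q * a) + Q * (P * a + Q * b)) + Q * (P * a + Q * b)
    recurrence = solve-∀

  lucasU-double : ∀ n → U (2 ℕ.* n) ≡ U n * V n
  lucasU-double zero = refl
  lucasU-double (suc m) = begin
    U (2 ℕ.* suc m)                                      ≡⟨ cong (λ i → U (suc (m ℕ.+ i))) (ℕ.+-identityʳ (suc m)) ⟩
    U (suc (m ℕ.+ suc m))                                ≡⟨ lucasU-+ m (suc m) ⟩
    U (suc m) * U (suc (suc m)) + Q * U m * U (suc m)   ≡⟨ factor Q (U (suc m)) (U (suc (suc m))) (U m) ⟩
    U (suc m) * (U (suc (suc m)) + Q * U m)              ≡⟨ cong (U (suc m) *_) (lucasV-suc m) ⟨
    U (suc m) * V (suc m)                                ∎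
    where
    open ≡-Reasoning
    factor : ∀ Q a b c → a * b + Q * c * a ≡ a * (b + Q * c)
    factor = solve-∀

module _ {P Q : ℤ} where

  private
    U V : ℕ → ℤ
    U = lucasU P Q
    V = lucasV P Q

  lucasU-odd : EvenInt P → OddInt Q → ∀ j → OddInt (U (suc (2 ℕ.* j)))
  lucasU-odd P-even Q-odd zero = + 0 , refl
  lucasU-odd P-even Q-odd (suc j) =
    subst (λ i → OddInt (U (suc i))) (sym (ℕ.*-suc 2 j))
      (even+odd (even-* P-even _) (odd-* Q-odd (lucasU-odd P-even Q-odd j)))

  lucasV-Val₂ : Val₂ P 1 → OddInt Q → ∀ n → Val₂ (V n) 1
  lucasV-Val₂ P-val Q-odd zero = Val₂-2
  lucasV-Val₂ P-val Q-odd (suc zero) = P-val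
  lucasV-Val₂ P-val Q-odd (suc (suc n)) =
    Val₂-+ (s≤s (s≤s z≤n))
      (Val₂-* P-val (lucasV-Val₂ P-val Q-odd (suc n)))
      (Val₂-* (Val₂-odd Q-odd) (lucasV-Val₂ P-val Q-odd n))

  lucasU-Val₂ : Val₂ P 1 → OddInt Q → ∀ g j → Val₂ (U (2 ^ g ℕ.* suc (2 ℕ.* j))) g
  lucasU-Val₂ P-val Q-odd zero j =
    subst (λ i → Val₂ (U i) 0) (sym (ℕ.*-identityˡ (suc (2 ℕ.* j))))
      (Val₂-odd (lucasU-odd (Val₂-suc⇒even P-val) Q-odd j))
  lucasU-Val₂ P-val Q-odd (suc g) j =
    subst₂ Val₂ (sym doubling) (ℕ.+-comm g 1)
      (Val₂-* (lucasU-Val₂ P-val Q-odd g j) (lucasV-Val₂ P-val Q-odd m))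
    where
    m : ℕ
    m = 2 ^ g ℕ.* suc (2 ℕ.* j)
    doubling : U (2 ^ suc g ℕ.* suc (2 ℕ.* j)) ≡ U m * V m
    doubling = trans (cong U (2^[1+g]*n g _)) (lucasU-double P Q m)

module _ (s t : ℤ) where

  private
    U W : ℕ → ℤ
    U = lucasU s t
    W = lucasU (s * s + + 2 * t) (- (t * t))

  lucasU-+4 : ∀ n → U (4 ℕ.+ n) ≡ (s * s + + 2 * t) * U (2 ℕ.+ n) + (- (t * t)) * U n
  lucasU-+4 n = unfold s t (U (suc n)) (U n)
    where
    unfold : ∀ s t a b → s * (s * (s * a + t * b) + t * a) + t * (s * a + t * b)
                       ≡ (s * s + + 2 * t) * (s * a + t * b) + (- (t * t)) * b
    unfold = solve-∀

  lucasU-bisection : ∀ k → U (2 ℕ.* k) ≡ s * W k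
  lucasU-bisection zero = sym (ℤ.*-zeroʳ s)
  lucasU-bisection (suc zero) = initial s t
    where
    initial : ∀ s t → s * + 1 + t * + 0 ≡ s * + 1
    initial = solve-∀
  lucasU-bisection (suc (suc k)) = begin
    U (2 ℕ.* suc (suc k))
      ≡⟨ cong U (trans (ℕ.*-suc 2 (suc k)) (cong (2 ℕ.+_) (ℕ.*-suc 2 k))) ⟩
    U (4 ℕ.+ 2 ℕ.* k)
      ≡⟨ lucasU-+4 (2 ℕ.* k) ⟩
    P′ * U (2 ℕ.+ 2 ℕ.* k) + Q′ * U (2 ℕ.* k)
      ≡⟨ cong₂ (λ a b → P′ * a + Q′ * b)
           (trans (cong U (sym (ℕ.*-suc 2 k))) (lucasU-bisection (suc k))) (lucasU-bisection k) ⟩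
    P′ * (s * W (suc k)) + Q′ * (s * W k)
      ≡⟨ factor s P′ Q′ (W (suc k)) (W k) ⟩
    s * W (suc (suc k))   ∎
    where
    open ≡-Reasoning
    P′ Q′ : ℤ
    P′ = s * s + + 2 * t
    Q′ = - (t * t)
    factor : ∀ s P Q a b → P * (s * a) + Q * (s * b) ≡ s * (P * a + Q * b)
    factor = solve-∀

+∞-∞ʳ : ∀ v → v +∞ ∞ ≡ ∞
+∞-∞ʳ (just _) = refl
+∞-∞ʳ nothing = refl

·∞-just : ∀ k e → k ·∞ just e ≡ just (k ℕ.* e)
·∞-just zero e = refl
·∞-just (suc k) e = refl

half-2* : ∀ a → half (+ 2 * a) ≡ a
half-2* (+ n) = trans (cong half (sym (ℤ.pos-* 2 n))) (cong +_ (2*n/2≡n n))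
half-2* -[1+ n ] = begin
  half (+ 2 * - + suc n)          ≡⟨ cong half (sym (ℤ.neg-distribʳ-* (+ 2) (+ suc n))) ⟩
  half (- (+ 2 * + suc n))        ≡⟨ cong (half ∘ -_) (sym (ℤ.pos-* 2 (suc n))) ⟩
  half (- + (2 ℕ.* suc n))        ≡⟨ cong (-_ ∘ +_) (2*n/2≡n (suc n)) ⟩
  -[1+ n ]                        ∎
  where open ≡-Reasoning

lucasFact-0-2+ : ∀ t n → lucasFact (+ 0) t (2 ℕ.+ n) ≡ + 0
lucasFact-0-2+ t zero = cong (λ x → + 1 * (+ 0 + x)) (ℤ.*-zeroʳ t)
lucasFact-0-2+ t (suc n) = cong (_* lucasU (+ 0) t (3 ℕ.+ n)) (lucasFact-0-2+ t n)

ν-lucasFact-0 : ∀ t n → ν (lucasFact (+ 0) t n) ≡ ν (+ (n !)) +∞ ((n / 2) ·∞ ν (half (+ 0)))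
ν-lucasFact-0 t zero = refl
ν-lucasFact-0 t (suc zero) = refl
ν-lucasFact-0 t (suc (suc n)) = begin
  ν (lucasFact (+ 0) t (2 ℕ.+ n))                          ≡⟨ cong ν (lucasFact-0-2+ t n) ⟩
  ∞                                                        ≡⟨ +∞-∞ʳ (ν (+ (suc (suc n) !))) ⟨
  ν (+ (suc (suc n) !)) +∞ (suc (n / 2) ·∞ ∞)              ≡⟨ cong (λ k → ν (+ (suc (suc n) !)) +∞ (k ·∞ ∞)) ([2+n]/2≡1+n/2 n) ⟨
  ν (+ (suc (suc n) !)) +∞ ((suc (suc n) / 2) ·∞ ∞)        ∎
  where open ≡-Reasoning

module _ {a t : ℤ} {e : ℕ} (a-val : Val₂ a e) (t-odd : OddInt t) where

  private
    s : ℤ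
    s = + 2 * a

  record FactorialVal₂ (n k : ℕ) : Set where
    constructor factorialVal₂
    field
      exponent : ℕ
      factorial-Val₂ : Val₂ (+ (n !)) exponent
      lucasFact-Val₂ : Val₂ (lucasFact s t n) (exponent ℕ.+ k ℕ.* e)

  lucasU-Val₂-even : ∀ {m} g j → m ≡ 2 ^ g ℕ.* suc (2 ℕ.* j) → Val₂ (lucasU s t (2 ℕ.* m)) (suc e ℕ.+ g)
  lucasU-Val₂-even g j refl =
    subst (λ x → Val₂ x (suc e ℕ.+ g)) (sym (lucasU-bisection s t (2 ^ g ℕ.* suc (2 ℕ.* j))))
      (Val₂-* (Val₂-* Val₂-2 a-val) (lucasU-Val₂ P′-val (odd-neg (odd-* t-odd t-odd)) g j))
    where
    P′-val : Val₂ (s * s + + 2 * t) 1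
    P′-val = val₂ (+ 2 * (a * a) + t) (even+odd (a * a , refl) t-odd) (regroup a t)
      where
      regroup : ∀ a t → + 2 * a * (+ 2 * a) + + 2 * t ≡ + 2 * (+ 2 * (a * a) + t)
      regroup = solve-∀

  step-odd : ∀ {k} → FactorialVal₂ (2 ℕ.* k) k → FactorialVal₂ (suc (2 ℕ.* k)) k
  step-odd {k} (factorialVal₂ f n!-val lf-val) = factorialVal₂ f
    (subst (λ x → Val₂ x f) (sym (ℤ.pos-* (suc (2 ℕ.* k)) ((2 ℕ.* k) !)))
      (Val₂-* (Val₂-odd (odd-1+2* k)) n!-val))
    (subst (Val₂ _) (ℕ.+-identityʳ _)
      (Val₂-* lf-val (Val₂-odd (lucasU-odd (a , refl) t-odd k))))

  step-even : ∀ {k} → FactorialVal₂ (suc (2 ℕ.* k)) k → FactorialVal₂ (2 ℕ.* suc k) (suc k)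
  step-even {k} (factorialVal₂ f n!-val lf-val) with 1+n≡2^g*odd k
  ... | g , j , 1+k≡ = subst (λ n → FactorialVal₂ n (suc k)) (sym (ℕ.*-suc 2 k))
    (factorialVal₂ (suc g ℕ.+ f)
      (subst (λ x → Val₂ x (suc g ℕ.+ f)) (sym (ℤ.pos-* (2 ℕ.+ 2 ℕ.* k) (suc (2 ℕ.* k) !)))
        (Val₂-* (Val₂-2^g*odd (suc g) j 2+2k≡) n!-val))
      (subst₂ Val₂ (cong (lucasFact s t (suc (2 ℕ.* k)) *_) (cong (lucasU s t) (ℕ.*-suc 2 k)))
        (exponents f k e g)
        (Val₂-* lf-val (lucasU-Val₂-even g j 1+k≡))))
    where
    2+2k≡ : 2 ℕ.+ 2 ℕ.* k ≡ 2 ^ suc g ℕ.* suc (2 ℕ.* j)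
    2+2k≡ = trans (sym (ℕ.*-suc 2 k)) (trans (cong (2 ℕ.*_) 1+k≡) (sym (2^[1+g]*n g (suc (2 ℕ.* j)))))
    exponents : ∀ f k e g → f ℕ.+ k ℕ.* e ℕ.+ (suc e ℕ.+ g) ≡ suc g ℕ.+ f ℕ.+ suc k ℕ.* e
    exponents = ℕ-Solver.solve-∀

  FactorialVal₂-even : ∀ k → FactorialVal₂ (2 ℕ.* k) k
  FactorialVal₂-even zero = factorialVal₂ 0 (Val₂-odd (+ 0 , refl)) (Val₂-odd (+ 0 , refl))
  FactorialVal₂-even (suc k) = step-even (step-odd (FactorialVal₂-even k))

  FactorialVal₂⇒ν : ∀ {n k} → FactorialVal₂ n k → n / 2 ≡ k →
                    ν (lucasFact s t n) ≡ ν (+ (n !)) +∞ ((n / 2) ·∞ ν (half s))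
  FactorialVal₂⇒ν {n} {k} (factorialVal₂ f n!-val lf-val) refl = begin
    ν (lucasFact s t n)                   ≡⟨ Val₂⇒ν lf-val ⟩
    just f +∞ just (k ℕ.* e)              ≡⟨ cong₂ _+∞_ (Val₂⇒ν n!-val) (·∞-just k e) ⟨
    ν (+ (n !)) +∞ (k ·∞ just e)          ≡⟨ cong (λ v → ν (+ (n !)) +∞ (k ·∞ v)) ν-half ⟨
    ν (+ (n !)) +∞ (k ·∞ ν (half s))      ∎
    where
    open ≡-Reasoning
    ν-half : ν (half s) ≡ just e
    ν-half = trans (cong ν (half-2* a)) (Val₂⇒ν a-val)

  ν-lucasFact : ∀ n → ν (lucasFact s t n) ≡ ν (+ (n !)) +∞ ((n / 2) ·∞ ν (half s))
  ν-lucasFact n with even-or-odd n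
  ... | k , inj₁ refl = FactorialVal₂⇒ν (FactorialVal₂-even k) (2*n/2≡n k)
  ... | k , inj₂ refl = FactorialVal₂⇒ν (step-odd (FactorialVal₂-even k)) ([1+2*n]/2≡n k)

corollary3p4 : (s t : ℤ) → EvenInt s → OddInt t → (n : ℕ) →
    ν (lucasFact s t n) ≡ (ν (+ (n !)) +∞ ((n / 2) ·∞ ν (half s)))
corollary3p4 s t (a , refl) t-odd n with zero⊎Val₂ a
... | inj₁ refl = ν-lucasFact-0 t n
... | inj₂ (e , a-val) = ν-lucasFact a-val t-odd n
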